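{- For positive integers $k<n\le m$: (a) $\mathcal{M}(k,n)\le\mathcal{M}(k,m)$; (b) $\mathcal{M}(k,n)+\mathcal{M}(k,m)\le\mathcal{M}(k,n+m)$.
   Context: $\mathcal{M}(k,n)$ is the maximum number of occurrences of $s_k=(k\ k{+}1)$ in a reduced word of the longest permutation $w_0=n\,(n-1)\cdots 2\,1$ of $S_n$. -}

module Defs where

open import Data.Nat using (ℕ; zero; suc; _≤_; _<_; _≟_)
open import Data.List using (List; []; _∷_; foldl; map; upTo; reverse; length; filter)
open import Data.List.Relation.Unary.All using (All)
open import Data.Product using (_×_; ∃)
open import Relation.Binary.PropositionalEquality using (_≡_)

-- Permutations of S_n in one-line notation (list of the values w(1),…,w(n)).
-- Right multiplication by s_i = (i i+1) swaps the entries at positions i, i+1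
-- (positions 1-indexed).
swapAt : ℕ → List ℕ → List ℕ
swapAt zero          xs           = xs
swapAt (suc zero)    []           = []
swapAt (suc zero)    (x ∷ [])     = x ∷ []
swapAt (suc zero)    (x ∷ y ∷ xs) = y ∷ x ∷ xs
swapAt (suc (suc i)) []           = []
swapAt (suc (suc i)) (x ∷ xs)     = x ∷ swapAt (suc i) xs

idPerm : ℕ → List ℕ
idPerm n = map suc (upTo n)

w₀ : ℕ → List ℕ
w₀ n = reverse (idPerm n)

IsWord : ℕ → List ℕ → Set
IsWord n w = All (λ i → 1 ≤ i × i < n) w

-- the product s_{a1} s_{a2} … s_{al} in one-line notation
prod : ℕ → List ℕ → List ℕ
prod n w = foldl (λ p i → swapAt i p) (idPerm n) w

ReducedWordW₀ : ℕ → List ℕ → Set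
ReducedWordW₀ n w =
  IsWord n w × prod n w ≡ w₀ n ×
  (∀ v → IsWord n v → prod n v ≡ w₀ n → length w ≤ length v)

occ : ℕ → List ℕ → ℕ
occ k w = length (filter (k ≟_) w)

IsM : ℕ → ℕ → ℕ → Set
IsM k n c =
  (∃ λ w → ReducedWordW₀ n w × occ k w ≡ c) ×
  (∀ w → ReducedWordW₀ n w → occ k w ≤ c)

-- A simple transposition changes the number of inversions by at most one; the
-- identity has none and w₀ has n(n-1)/2, so the reduced words of w₀ in Sₙ are
-- exactly its words of length n(n-1)/2.  If u and w are reduced words of w₀ in
-- Sₘ and Sₙ, then u · B · w, where B is a reduced word of the block
-- transposition moving the last n of n+m letters in front of the first m, is a
-- word for w₀ in Sₙ₊ₘ of length m(m-1)/2 + mn + n(n-1)/2, hence reduced, and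
-- it contains every occurrence of s_k in u and in w.  This gives (b); for (a),
-- join a reduced word of w₀ in Sₙ with any reduced word of w₀ in Sₘ₋ₙ.
module Submission where

open import Defs
open import Data.Nat using (ℕ; zero; suc; _+_; _*_; _∸_; _≤_; _<_; z≤n; s≤s; _≟_)
open import Data.Nat.Properties
open import Data.Product using (_×_; _,_; proj₁; proj₂)
open import Data.List using (List; []; _∷_; _++_; [_]; map; foldl; length; filter; upTo; reverse; applyDownFrom)
open import Data.List.Properties using (foldl-++; map-++; map-∘; map-id; length-map; length-upTo; length-++; length-applyDownFrom; ++-assoc; ++-identityʳ; filter-++; map-upTo; reverse-applyUpTo)
open import Data.List.Relation.Unary.All using (All; []; _∷_) renaming (map to All-map)
open import Data.List.Relation.Unary.All.Properties using (++⁺; map⁺)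
open import Relation.Binary.PropositionalEquality hiding ([_])
open import Data.Nat.Solver using (module +-*-Solver)
open +-*-Solver using (solve; _:+_; _:*_; _:=_; con)

act : List ℕ → List ℕ → List ℕ
act p w = foldl (λ q i → swapAt i q) p w

act-++ : ∀ p u v → act p (u ++ v) ≡ act (act p u) v
act-++ p = foldl-++ (λ q i → swapAt i q) p

descending : ℕ → List ℕ
descending = applyDownFrom suc

w₀≡descending : ∀ n → w₀ n ≡ descending n
w₀≡descending n = trans (cong reverse (map-upTo suc n)) (reverse-applyUpTo suc n)

idPerm-suc : ∀ n → idPerm (suc n) ≡ 1 ∷ map suc (idPerm n)
idPerm-suc n = cong (1 ∷_) (cong (map suc) (sym (map-upTo suc n)))

length-idPerm : ∀ n → length (idPerm n) ≡ n
length-idPerm n = trans (length-map suc (upTo n)) (length-upTo n)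

triangular : ℕ → ℕ
triangular zero    = 0
triangular (suc n) = n + triangular n

triangular-+ : ∀ a b → triangular (a + b) ≡ triangular a + triangular b + a * b
triangular-+ zero    b = sym (+-identityʳ (triangular b))
triangular-+ (suc a) b = trans (cong (a + b +_) (triangular-+ a b))
  (solve 4 (λ a b ta tb → (a :+ b) :+ ((ta :+ tb) :+ a :* b) := ((a :+ ta) :+ tb) :+ (b :+ a :* b))
     refl a b (triangular a) (triangular b))

IsWord-mono : ∀ {m n} w → m ≤ n → IsWord m w → IsWord n w
IsWord-mono w m≤n = All-map λ { (1≤i , i<m) → 1≤i , ≤-trans i<m m≤n }

IsWord-map-suc : ∀ {n} w → IsWord n w → IsWord (suc n) (map suc w)
IsWord-map-suc w ws = map⁺ (All-map (λ { (_ , i<n) → s≤s z≤n , s≤s i<n }) ws)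

length-swapAt : ∀ i xs → length (swapAt i xs) ≡ length xs
length-swapAt zero          xs           = refl
length-swapAt (suc zero)    []           = refl
length-swapAt (suc zero)    (x ∷ [])     = refl
length-swapAt (suc zero)    (x ∷ y ∷ xs) = refl
length-swapAt (suc (suc i)) []           = refl
length-swapAt (suc (suc i)) (x ∷ xs)     = cong suc (length-swapAt (suc i) xs)

swapAt-++ : ∀ i xs ys → i < length xs → swapAt i (xs ++ ys) ≡ swapAt i xs ++ ys
swapAt-++ zero          xs           ys _         = refl
swapAt-++ (suc zero)    (x ∷ y ∷ xs) ys _         = refl
swapAt-++ (suc zero)    (x ∷ [])     ys (s≤s ())
swapAt-++ (suc (suc i)) (x ∷ xs)     ys (s≤s i<∣xs∣) = cong (x ∷_) (swapAt-++ (suc i) xs ys i<∣xs∣)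

act-++-prefix : ∀ xs ys w → All (_< length xs) w → act (xs ++ ys) w ≡ act xs w ++ ys
act-++-prefix xs ys []      _                = refl
act-++-prefix xs ys (i ∷ w) (i<∣xs∣ ∷ w<∣xs∣) =
  trans (cong (λ q → act q w) (swapAt-++ i xs ys i<∣xs∣))
        (act-++-prefix (swapAt i xs) ys w (subst (λ l → All (_< l) w) (sym (length-swapAt i xs)) w<∣xs∣))

act-++-word : ∀ {n} xs ys w → length xs ≡ n → IsWord n w → act (xs ++ ys) w ≡ act xs w ++ ys
act-++-word xs ys w refl ws = act-++-prefix xs ys w (All-map proj₂ ws)

swapAt-map : ∀ (f : ℕ → ℕ) i xs → swapAt i (map f xs) ≡ map f (swapAt i xs)
swapAt-map f zero          xs           = refl
swapAt-map f (suc zero)    []           = refl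
swapAt-map f (suc zero)    (x ∷ [])     = refl
swapAt-map f (suc zero)    (x ∷ y ∷ xs) = refl
swapAt-map f (suc (suc i)) []           = refl
swapAt-map f (suc (suc i)) (x ∷ xs)     = cong (f x ∷_) (swapAt-map f (suc i) xs)

act-map : ∀ (f : ℕ → ℕ) xs w → act (map f xs) w ≡ map f (act xs w)
act-map f xs []      = refl
act-map f xs (i ∷ w) = trans (cong (λ q → act q w) (swapAt-map f i xs)) (act-map f (swapAt i xs) w)

act-∷-map-suc : ∀ x xs w → All (1 ≤_) w → act (x ∷ xs) (map suc w) ≡ x ∷ act xs w
act-∷-map-suc x xs []          _       = refl
act-∷-map-suc x xs (suc i ∷ w) (_ ∷ ws) = act-∷-map-suc x (swapAt (suc i) xs) w ws

act-∷-word : ∀ {n} x xs w → IsWord n w → act (x ∷ xs) (map suc w) ≡ x ∷ act xs w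
act-∷-word x xs w ws = act-∷-map-suc x xs w (All-map proj₁ ws)

ltIndicator : ℕ → ℕ → ℕ
ltIndicator _       zero    = 0
ltIndicator zero    (suc _) = 1
ltIndicator (suc a) (suc b) = ltIndicator a b

ltIndicator≤1 : ∀ a b → ltIndicator a b ≤ 1
ltIndicator≤1 _       zero    = z≤n
ltIndicator≤1 zero    (suc _) = s≤s z≤n
ltIndicator≤1 (suc a) (suc b) = ltIndicator≤1 a b

ltIndicator-< : ∀ {a b} → a < b → ltIndicator a b ≡ 1
ltIndicator-< {zero}  {suc b} _         = refl
ltIndicator-< {suc a} {suc b} (s≤s a<b) = ltIndicator-< a<b

countBelow : ℕ → List ℕ → ℕ
countBelow z []       = 0
countBelow z (y ∷ ys) = ltIndicator y z + countBelow z ys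

inversions : List ℕ → ℕ
inversions []       = 0
inversions (x ∷ xs) = countBelow x xs + inversions xs

countBelow-swapAt : ∀ z i xs → countBelow z (swapAt i xs) ≡ countBelow z xs
countBelow-swapAt z zero          xs           = refl
countBelow-swapAt z (suc zero)    []           = refl
countBelow-swapAt z (suc zero)    (x ∷ [])     = refl
countBelow-swapAt z (suc zero)    (x ∷ y ∷ xs) = solve 3 (λ a b c → a :+ (b :+ c) := b :+ (a :+ c)) refl
  (ltIndicator y z) (ltIndicator x z) (countBelow z xs)
countBelow-swapAt z (suc (suc i)) []           = refl
countBelow-swapAt z (suc (suc i)) (x ∷ xs)     = cong (ltIndicator x z +_) (countBelow-swapAt z (suc i) xs)

inversions-swapAt : ∀ i xs → inversions (swapAt i xs) ≤ suc (inversions xs)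
inversions-swapAt zero          xs           = n≤1+n _
inversions-swapAt (suc zero)    []           = n≤1+n _
inversions-swapAt (suc zero)    (x ∷ [])     = n≤1+n _
inversions-swapAt (suc zero)    (x ∷ y ∷ xs) = begin
    (ltIndicator x y + cy) + (cx + I)
      ≤⟨ +-monoˡ-≤ (cx + I) (+-monoˡ-≤ cy (ltIndicator≤1 x y)) ⟩
    (1 + cy) + (cx + I)
      ≡⟨ solve 3 (λ cy cx I → (con 1 :+ cy) :+ (cx :+ I) := con 1 :+ (cx :+ (cy :+ I))) refl cy cx I ⟩
    suc (cx + (cy + I))
      ≤⟨ s≤s (+-monoˡ-≤ (cy + I) (m≤n+m cx (ltIndicator y x))) ⟩
    suc ((ltIndicator y x + cx) + (cy + I)) ∎
  where
  open ≤-Reasoning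
  cy = countBelow y xs
  cx = countBelow x xs
  I  = inversions xs
inversions-swapAt (suc (suc i)) []           = n≤1+n _
inversions-swapAt (suc (suc i)) (x ∷ xs)     = begin
    countBelow x (swapAt (suc i) xs) + inversions (swapAt (suc i) xs)
      ≡⟨ cong (_+ inversions (swapAt (suc i) xs)) (countBelow-swapAt x (suc i) xs) ⟩
    countBelow x xs + inversions (swapAt (suc i) xs)
      ≤⟨ +-monoʳ-≤ (countBelow x xs) (inversions-swapAt (suc i) xs) ⟩
    countBelow x xs + suc (inversions xs)
      ≡⟨ +-suc (countBelow x xs) (inversions xs) ⟩
    suc (countBelow x xs + inversions xs) ∎
  where open ≤-Reasoning

inversions-act : ∀ p w → inversions (act p w) ≤ inversions p + length w
inversions-act p []      = ≤-reflexive (sym (+-identityʳ _))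
inversions-act p (i ∷ w) = begin
    inversions (act (swapAt i p) w)        ≤⟨ inversions-act (swapAt i p) w ⟩
    inversions (swapAt i p) + length w     ≤⟨ +-monoˡ-≤ (length w) (inversions-swapAt i p) ⟩
    suc (inversions p) + length w          ≡⟨ sym (+-suc (inversions p) (length w)) ⟩
    inversions p + length (i ∷ w)          ∎
  where open ≤-Reasoning

countBelow-map-suc : ∀ x l → countBelow (suc x) (map suc l) ≡ countBelow x l
countBelow-map-suc x []      = refl
countBelow-map-suc x (y ∷ l) = cong (ltIndicator y x +_) (countBelow-map-suc x l)

inversions-map-suc : ∀ l → inversions (map suc l) ≡ inversions l
inversions-map-suc []      = refl
inversions-map-suc (x ∷ l) = cong₂ _+_ (countBelow-map-suc x l) (inversions-map-suc l)

inversions-idPerm : ∀ n → inversions (idPerm n) ≡ 0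
inversions-idPerm zero    = refl
inversions-idPerm (suc n) = begin
    inversions (idPerm (suc n))
      ≡⟨ cong inversions (idPerm-suc n) ⟩
    countBelow 1 (map suc (idPerm n)) + inversions (map suc (idPerm n))
      ≡⟨ cong₂ _+_ (countBelow-map-suc 0 (idPerm n)) (inversions-map-suc (idPerm n)) ⟩
    countBelow 0 (idPerm n) + inversions (idPerm n)
      ≡⟨ cong₂ _+_ (countBelow-0 (idPerm n)) (inversions-idPerm n) ⟩
    0 ∎
  where
  open ≡-Reasoning
  countBelow-0 : ∀ l → countBelow 0 l ≡ 0
  countBelow-0 []      = refl
  countBelow-0 (_ ∷ l) = countBelow-0 l

countBelow-descending : ∀ {n z} → n ≤ z → countBelow (suc z) (descending n) ≡ n
countBelow-descending {zero}      _   = refl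
countBelow-descending {suc n} {z} n<z =
  cong₂ _+_ (ltIndicator-< n<z) (countBelow-descending (≤-trans (n≤1+n n) n<z))

inversions-descending : ∀ n → inversions (descending n) ≡ triangular n
inversions-descending zero    = refl
inversions-descending (suc n) = cong₂ _+_ (countBelow-descending ≤-refl) (inversions-descending n)

triangular≤length : ∀ n v → act (idPerm n) v ≡ descending n → triangular n ≤ length v
triangular≤length n v v↦w₀ = begin
    triangular n                           ≡⟨ sym (inversions-descending n) ⟩
    inversions (descending n)              ≡⟨ cong inversions (sym v↦w₀) ⟩
    inversions (act (idPerm n) v)          ≤⟨ inversions-act (idPerm n) v ⟩
    inversions (idPerm n) + length v       ≡⟨ cong (_+ length v) (inversions-idPerm n) ⟩
    length v                               ∎
  where open ≤-Reasoning

bringToFront : ℕ → List ℕ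
bringToFront zero    = []
bringToFront (suc l) = map suc (bringToFront l) ++ [ 1 ]

IsWord-bringToFront : ∀ l → IsWord (suc l) (bringToFront l)
IsWord-bringToFront zero    = []
IsWord-bringToFront (suc l) =
  ++⁺ (IsWord-map-suc (bringToFront l) (IsWord-bringToFront l)) ((s≤s z≤n , s≤s (s≤s z≤n)) ∷ [])

length-bringToFront : ∀ l → length (bringToFront l) ≡ l
length-bringToFront zero    = refl
length-bringToFront (suc l) = begin
    length (map suc (bringToFront l) ++ [ 1 ])
      ≡⟨ length-++ (map suc (bringToFront l)) ⟩
    length (map suc (bringToFront l)) + 1
      ≡⟨ cong (_+ 1) (trans (length-map suc (bringToFront l)) (length-bringToFront l)) ⟩
    l + 1
      ≡⟨ +-comm l 1 ⟩
    suc l ∎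
  where open ≡-Reasoning

act-bringToFront : ∀ xs y → act (xs ++ [ y ]) (bringToFront (length xs)) ≡ y ∷ xs
act-bringToFront []       y = refl
act-bringToFront (x ∷ xs) y = begin
    act (x ∷ xs ++ [ y ]) (map suc (bringToFront (length xs)) ++ [ 1 ])
      ≡⟨ act-++ (x ∷ xs ++ [ y ]) (map suc (bringToFront (length xs))) [ 1 ] ⟩
    act (act (x ∷ xs ++ [ y ]) (map suc (bringToFront (length xs)))) [ 1 ]
      ≡⟨ cong (λ q → act q [ 1 ]) (act-∷-word x (xs ++ [ y ]) _ (IsWord-bringToFront (length xs))) ⟩
    act (x ∷ act (xs ++ [ y ]) (bringToFront (length xs))) [ 1 ]
      ≡⟨ cong (λ q → act (x ∷ q) [ 1 ]) (act-bringToFront xs y) ⟩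
    y ∷ x ∷ xs ∎
  where open ≡-Reasoning

blockSwap : ℕ → ℕ → List ℕ
blockSwap l zero    = []
blockSwap l (suc n) = bringToFront l ++ map suc (blockSwap l n)

IsWord-blockSwap : ∀ l n → IsWord (l + n) (blockSwap l n)
IsWord-blockSwap l zero    = []
IsWord-blockSwap l (suc n) rewrite +-suc l n =
  ++⁺ (IsWord-mono (bringToFront l) (s≤s (m≤m+n l n)) (IsWord-bringToFront l))
      (IsWord-map-suc (blockSwap l n) (IsWord-blockSwap l n))

length-blockSwap : ∀ l n → length (blockSwap l n) ≡ n * l
length-blockSwap l zero    = refl
length-blockSwap l (suc n) = trans (length-++ (bringToFront l))
  (cong₂ _+_ (length-bringToFront l) (trans (length-map suc (blockSwap l n)) (length-blockSwap l n)))

act-blockSwap : ∀ xs ys → act (xs ++ ys) (blockSwap (length xs) (length ys)) ≡ ys ++ xs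
act-blockSwap xs []       = ++-identityʳ xs
act-blockSwap xs (y ∷ ys) = begin
    act (xs ++ y ∷ ys) (front ++ map suc rest)
      ≡⟨ act-++ (xs ++ y ∷ ys) front (map suc rest) ⟩
    act (act (xs ++ y ∷ ys) front) (map suc rest)
      ≡⟨ cong (λ q → act (act q front) (map suc rest)) (sym (++-assoc xs [ y ] ys)) ⟩
    act (act ((xs ++ [ y ]) ++ ys) front) (map suc rest)
      ≡⟨ cong (λ q → act q (map suc rest)) (act-++-word (xs ++ [ y ]) ys front ∣xs∷ʳy∣ (IsWord-bringToFront (length xs))) ⟩
    act (act (xs ++ [ y ]) front ++ ys) (map suc rest)
      ≡⟨ cong (λ q → act (q ++ ys) (map suc rest)) (act-bringToFront xs y) ⟩
    act (y ∷ xs ++ ys) (map suc rest)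
      ≡⟨ act-∷-word y (xs ++ ys) rest (IsWord-blockSwap (length xs) (length ys)) ⟩
    y ∷ act (xs ++ ys) rest
      ≡⟨ cong (y ∷_) (act-blockSwap xs ys) ⟩
    y ∷ ys ++ xs ∎
  where
  open ≡-Reasoning
  front = bringToFront (length xs)
  rest  = blockSwap (length xs) (length ys)
  ∣xs∷ʳy∣ : length (xs ++ [ y ]) ≡ suc (length xs)
  ∣xs∷ʳy∣ = trans (length-++ xs) (+-comm (length xs) 1)

idPerm-+ : ∀ a b → idPerm (a + b) ≡ idPerm a ++ map (a +_) (idPerm b)
idPerm-+ zero    b = sym (map-id (idPerm b))
idPerm-+ (suc a) b = begin
    idPerm (suc (a + b))
      ≡⟨ idPerm-suc (a + b) ⟩
    1 ∷ map suc (idPerm (a + b))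
      ≡⟨ cong (λ q → 1 ∷ map suc q) (idPerm-+ a b) ⟩
    1 ∷ map suc (idPerm a ++ map (a +_) (idPerm b))
      ≡⟨ cong (1 ∷_) (map-++ suc (idPerm a) _) ⟩
    1 ∷ map suc (idPerm a) ++ map suc (map (a +_) (idPerm b))
      ≡⟨ cong (λ q → 1 ∷ map suc (idPerm a) ++ q) (sym (map-∘ (idPerm b))) ⟩
    (1 ∷ map suc (idPerm a)) ++ map (suc a +_) (idPerm b)
      ≡⟨ cong (_++ map (suc a +_) (idPerm b)) (sym (idPerm-suc a)) ⟩
    idPerm (suc a) ++ map (suc a +_) (idPerm b) ∎
  where open ≡-Reasoning

descending-+ : ∀ a b → descending (a + b) ≡ map (b +_) (descending a) ++ descending b
descending-+ zero    b = refl
descending-+ (suc a) b = cong₂ _∷_ (trans (cong suc (+-comm a b)) (sym (+-suc b a))) (descending-+ a b)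

ShortW₀Word : ℕ → List ℕ → Set
ShortW₀Word n w = IsWord n w × act (idPerm n) w ≡ descending n × length w ≡ triangular n

act-join : ∀ m n u w → IsWord m u → act (idPerm m) u ≡ descending m →
           IsWord n w → act (idPerm n) w ≡ descending n →
           act (idPerm (n + m)) (u ++ blockSwap m n ++ w) ≡ descending (n + m)
act-join m n u w u-word u↦w₀ w-word w↦w₀ = begin
    act (idPerm (n + m)) (u ++ blockSwap m n ++ w)
      ≡⟨ cong (λ q → act q (u ++ blockSwap m n ++ w)) (trans (cong idPerm (+-comm n m)) (idPerm-+ m n)) ⟩
    act (idPerm m ++ high) (u ++ blockSwap m n ++ w)
      ≡⟨ act-++ (idPerm m ++ high) u _ ⟩
    act (act (idPerm m ++ high) u) (blockSwap m n ++ w)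
      ≡⟨ cong (λ q → act q (blockSwap m n ++ w)) (act-++-word (idPerm m) high u (length-idPerm m) u-word) ⟩
    act (act (idPerm m) u ++ high) (blockSwap m n ++ w)
      ≡⟨ cong (λ q → act (q ++ high) (blockSwap m n ++ w)) u↦w₀ ⟩
    act (descending m ++ high) (blockSwap m n ++ w)
      ≡⟨ act-++ (descending m ++ high) (blockSwap m n) w ⟩
    act (act (descending m ++ high) (blockSwap m n)) w
      ≡⟨ cong (λ q → act q w) swapped ⟩
    act (high ++ descending m) w
      ≡⟨ act-++-word high (descending m) w length-high w-word ⟩
    act high w ++ descending m
      ≡⟨ cong (_++ descending m) (act-map (m +_) (idPerm n) w) ⟩
    map (m +_) (act (idPerm n) w) ++ descending m
      ≡⟨ cong (λ q → map (m +_) q ++ descending m) w↦w₀ ⟩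
    map (m +_) (descending n) ++ descending m
      ≡⟨ sym (descending-+ n m) ⟩
    descending (n + m) ∎
  where
  open ≡-Reasoning
  high = map (m +_) (idPerm n)
  length-high : length high ≡ n
  length-high = trans (length-map (m +_) (idPerm n)) (length-idPerm n)
  swapped : act (descending m ++ high) (blockSwap m n) ≡ high ++ descending m
  swapped = subst₂ (λ a b → act (descending m ++ high) (blockSwap a b) ≡ high ++ descending m)
    (length-applyDownFrom suc m) length-high (act-blockSwap (descending m) high)

ShortW₀Word-join : ∀ {m n u w} → ShortW₀Word m u → ShortW₀Word n w →
                   ShortW₀Word (n + m) (u ++ blockSwap m n ++ w)
ShortW₀Word-join {m} {n} {u} {w} (u-word , u↦w₀ , ∣u∣) (w-word , w↦w₀ , ∣w∣) =
  ++⁺ (IsWord-mono u (m≤n+m m n) u-word)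
      (++⁺ (IsWord-mono (blockSwap m n) (≤-reflexive (+-comm m n)) (IsWord-blockSwap m n))
           (IsWord-mono w (m≤m+n n m) w-word)) ,
  act-join m n u w u-word u↦w₀ w-word w↦w₀ ,
  length-join
  where
  open ≡-Reasoning
  length-join : length (u ++ blockSwap m n ++ w) ≡ triangular (n + m)
  length-join = begin
    length (u ++ blockSwap m n ++ w)
      ≡⟨ length-++ u ⟩
    length u + length (blockSwap m n ++ w)
      ≡⟨ cong (length u +_) (length-++ (blockSwap m n)) ⟩
    length u + (length (blockSwap m n) + length w)
      ≡⟨ cong₂ (λ a b → a + (b + length w)) ∣u∣ (length-blockSwap m n) ⟩
    triangular m + (n * m + length w)
      ≡⟨ cong (λ a → triangular m + (n * m + a)) ∣w∣ ⟩
    triangular m + (n * m + triangular n)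
      ≡⟨ solve 3 (λ tm nm tn → tm :+ (nm :+ tn) := (tn :+ tm) :+ nm) refl (triangular m) (n * m) (triangular n) ⟩
    triangular n + triangular m + n * m
      ≡⟨ sym (triangular-+ n m) ⟩
    triangular (n + m) ∎

standardW₀Word : ℕ → List ℕ
standardW₀Word zero    = []
standardW₀Word (suc n) = standardW₀Word n ++ blockSwap n 1 ++ []

ShortW₀Word-standard : ∀ n → ShortW₀Word n (standardW₀Word n)
ShortW₀Word-standard zero    = [] , refl , refl
ShortW₀Word-standard (suc n) = ShortW₀Word-join (ShortW₀Word-standard n) ([] , refl , refl)

short⇒reduced : ∀ {n w} → ShortW₀Word n w → ReducedWordW₀ n w
short⇒reduced {n} (w-word , w↦w₀ , ∣w∣) = w-word , trans w↦w₀ (sym (w₀≡descending n)) ,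
  λ v _ v↦w₀ → subst (_≤ length v) (sym ∣w∣) (triangular≤length n v (trans v↦w₀ (w₀≡descending n)))

reduced⇒short : ∀ {n w} → ReducedWordW₀ n w → ShortW₀Word n w
reduced⇒short {n} {w} (w-word , w↦w₀ , minimal) with ShortW₀Word-standard n
... | s-word , s↦w₀ , ∣s∣ =
  w-word , trans w↦w₀ (w₀≡descending n) ,
  ≤-antisym (subst (length w ≤_) ∣s∣ (minimal (standardW₀Word n) s-word (trans s↦w₀ (sym (w₀≡descending n)))))
            (triangular≤length n w (trans w↦w₀ (w₀≡descending n)))

ReducedWordW₀-join : ∀ {m n u w} → ReducedWordW₀ m u → ReducedWordW₀ n w →
                     ReducedWordW₀ (n + m) (u ++ blockSwap m n ++ w)
ReducedWordW₀-join u-red w-red = short⇒reduced (ShortW₀Word-join (reduced⇒short u-red) (reduced⇒short w-red))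

ReducedWordW₀-standard : ∀ n → ReducedWordW₀ n (standardW₀Word n)
ReducedWordW₀-standard n = short⇒reduced (ShortW₀Word-standard n)

occ-++ : ∀ k u v → occ k (u ++ v) ≡ occ k u + occ k v
occ-++ k u v = trans (cong length (filter-++ (k ≟_) u v)) (length-++ (filter (k ≟_) u))

occ-join : ∀ k u v w → occ k u + occ k w ≤ occ k (u ++ v ++ w)
occ-join k u v w = begin
    occ k u + occ k w                 ≤⟨ +-monoʳ-≤ (occ k u) (m≤n+m (occ k w) (occ k v)) ⟩
    occ k u + (occ k v + occ k w)     ≡⟨ cong (occ k u +_) (sym (occ-++ k v w)) ⟩
    occ k u + occ k (v ++ w)          ≡⟨ sym (occ-++ k u (v ++ w)) ⟩
    occ k (u ++ v ++ w)               ∎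
  where open ≤-Reasoning

lemma4p2 : (k n m : ℕ) → 1 ≤ k → k < n → n ≤ m →
    (∀ a b → IsM k n a → IsM k m b → a ≤ b) ×
    (∀ a b c → IsM k n a → IsM k m b → IsM k (n + m) c → a + b ≤ c)
lemma4p2 k n m _ _ n≤m = monotone , superadditive
  where
  monotone : ∀ a b → IsM k n a → IsM k m b → a ≤ b
  monotone _ b ((w , w-red , refl) , _) (_ , maximalₘ) = begin
    occ k w                            ≤⟨ m≤m+n (occ k w) _ ⟩
    occ k w + occ k (standardW₀Word d) ≤⟨ occ-join k w (blockSwap n d) (standardW₀Word d) ⟩
    occ k W                            ≤⟨ maximalₘ W W-red ⟩
    b                                  ∎
    where
    open ≤-Reasoning
    d = m ∸ n
    W = w ++ blockSwap n d ++ standardW₀Word d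
    W-red : ReducedWordW₀ m W
    W-red = subst (λ N → ReducedWordW₀ N W) (m∸n+n≡m n≤m)
                  (ReducedWordW₀-join w-red (ReducedWordW₀-standard d))
  superadditive : ∀ a b c → IsM k n a → IsM k m b → IsM k (n + m) c → a + b ≤ c
  superadditive _ _ c ((w , w-red , refl) , _) ((u , u-red , refl) , _) (_ , maximalₙ₊ₘ) = begin
    occ k w + occ k u               ≡⟨ +-comm (occ k w) (occ k u) ⟩
    occ k u + occ k w               ≤⟨ occ-join k u (blockSwap m n) w ⟩
    occ k (u ++ blockSwap m n ++ w) ≤⟨ maximalₙ₊ₘ _ (ReducedWordW₀-join u-red w-red) ⟩
    c                               ∎
    where open ≤-Reasoning
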